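{- Let $t=s\sum_{\vec y}e^{2i\pi(\frac{y_0}{2}\widehat Q+\frac{y_0'}{2}\widehat{Q'}+R)}|\vec O\rangle\langle\vec I|$ be an SOP morphism where $y_0\neq y_0'$ are summation variables, $Q,Q'$ are boolean polynomials, $R$ is a phase polynomial, and $y_0,y_0'\notin\mathrm{Var}(Q,Q',R,\vec O,\vec I)$. Then $$t\sim_{\mathrm{TH}} 2s\sum_{\vec y\setminus\{y_0'\}}e^{2i\pi(\frac{y_0}{2}(\widehat Q+\widehat{Q'}+\widehat{QQ'})+R)}|\vec O\rangle\langle\vec I|,$$ i.e. the rule (HHnl), $t\to 2\,t[y_0'\leftarrow y_0\oplus y_0Q]$ (with $y_0'$ removed from the summation), is derivable in $\sim_{\mathrm{TH}}$.
   Context: An SOP morphism $t:n\to m$ is a formal expression $t=s\sum_{\vec y\in V^k}e^{2i\pi P(\vec y)}|\vec O(\vec y)\rangle\langle\vec I(\vec y)|$ where $s\in\mathbb R$, $\vec y=(y_1,\dots,y_k)$ are distinct boolean summation variables, the phase polynomial $P$ lies in $\mathbb R[y_1,\dots,y_k]/(y_j^2-y_j)$, $\vec O\in\mathbb F_2[\vec y]^m$, $\vec I\in\mathbb F_2[\vec y]^n$. Morphisms are identified up to renaming of summation variables, and phase polynomials are identified when their difference has integer coefficients. For $Q\in\mathbb F_2[\vec y]$, $\widehat Q$ is the real multilinear polynomial defined by $\widehat{Q_1Q_2}=\widehat{Q_1}\widehat{Q_2}$, $\widehat{Q_1\oplus Q_2}=\widehat{Q_1}+\widehat{Q_2}-2\widehat{Q_1}\widehat{Q_2}$,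 $\widehat{y_j}=y_j$, $\widehat0=0$, $\widehat1=1$. Notation: $\mathrm{Var}(\cdot)$ is the set of variables occurring in a collection of polynomials; $t[y\leftarrow Q]$ denotes substitution of $Q$ for $y$ in $\vec O,\vec I$ and of $\widehat Q$ for $y$ in $P$. The rewrite relation $\to_{\mathrm{TH}}$ consists of the following rules, applied to whole morphisms (scalar $s$ carried along unless stated): (Elim) $s\sum_{\vec y}e^{2i\pi P}|\vec O\rangle\langle\vec I|\to 2s\sum_{\vec y\setminus\{y_0\}}e^{2i\pi P}|\vec O\rangle\langle\vec I|$ if $y_0$ is a summation variable not in $\mathrm{Var}(P,\vec O,\vec I)$. (HHgen) $t=s\sum_{\vec y}e^{2i\pi(\frac{y_0}{2}(y_i\widehat Q+\widehat{Q'}+1)+R)}|\vec O\rangle\langle\vec I|\to t[y_i\leftarrow 1\oplus Q']$ (with $y_i$ removed from the summation), provided $y_0\neq y_i$ are summation variables, $QQ'=Q'$, $y_0\notin\mathrm{Var}(Q,Q',R,\vec O,\vec I)$, $y_i\notin\mathrm{Var}(Q,Q')$. The case $Q=1$ is called (HH). (ket) If $O_i=y_0\oplus O_i'$ with $O_i'\neq0$ and $y_0\notin\mathrm{Var}(O_1,\dots,O_{i-1},O_i')$, then $t\to t[y_0\leftarrow O_i]$ ($y_0$ stays a summation variable). (bra) If $I_i=y_0\oplus I_i'$ with $I_i'\neq0$ and $y_0\notin\mathrm{Var}(\vec O,I_1,\dots,I_{i-1},I_i')$, then $t\to t[y_0\leftarrow I_i]$. (Z) $s\sum_{\vec y}e^{2i\pi(\frac{y_0}{2}+R)}|\vec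 O\rangle\langle\vec I|\to\sum_{y_0}e^{2i\pi\frac{y_0}{2}}|0\cdots0\rangle\langle0\cdots0|$ provided $y_0\notin\mathrm{Var}(R,\vec O,\vec I)$ and ($R\neq0$ or $\vec O,\vec I$ not all zero). $\sim_{\mathrm{TH}}$ is the equivalence relation generated by $\to_{\mathrm{TH}}$. -}

module Defs where

open import Level using (Level; _⊔_) renaming (suc to lsuc)
open import Algebra.Bundles using (CommutativeRing)
open import Data.Bool using (Bool; true; false; _xor_; _∧_; not)
open import Data.Nat using (ℕ; zero; suc)
open import Data.Integer using (ℤ; +_; -[1+_])
open import Data.Fin using (Fin; toℕ) renaming (zero to fzero)
import Data.Nat as ℕ
open import Data.Vec.Functional using (insertAt; updateAt)
open import Data.Product using (Σ; ∃; _×_; _,_)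
open import Data.Sum using (_⊎_)
open import Function using (_∘_; const)
open import Function.Bundles using (_↔_; Inverse)
open import Relation.Binary.PropositionalEquality using (_≡_; _≢_)
open import Relation.Nullary using (¬_)

-- The paper uses ℝ; agda-stdlib
-- has no reals, so we work over an arbitrary commutative ring of
-- characteristic 0 in which 2 is invertible (ℝ is an instance).

module _ {c ℓ : Level} (R : CommutativeRing c ℓ) where
  open CommutativeRing R

  ℕ→R : ℕ → Carrier
  ℕ→R zero    = 0#
  ℕ→R (suc n) = 1# + ℕ→R n

  ℤ→R : ℤ → Carrier
  ℤ→R (+ n)      = ℕ→R n
  ℤ→R -[1+ n ]   = - ℕ→R (suc n)

  record IsPhaseRing : Set (c ⊔ ℓ) where
    field
      half      : Carrier
      half+half : half + half ≈ 1#
      char0     : ∀ z → ℤ→R z ≈ 0# → z ≡ + 0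

module SOPs {c ℓ : Level} (R : CommutativeRing c ℓ) (PR : IsPhaseRing R) where
  open CommutativeRing R
  open IsPhaseRing PR

  Pt : ℕ → Set
  Pt k = Fin k → Bool

  -- Boolean polynomials  𝔽₂[y₁..yₖ]/(yⱼ²-yⱼ)  ≅ functions on the cube
  BPoly : ℕ → Set
  BPoly k = Pt k → Bool

  -- Phase polynomials  ℝ[y₁..yₖ]/(yⱼ²-yⱼ)  ≅ functions on the cube
  PPoly : ℕ → Set c
  PPoly k = Pt k → Carrier

  ⟦_⟧ : Bool → Carrier
  ⟦ true ⟧  = 1#
  ⟦ false ⟧ = 0#

  hat : ∀ {k} → BPoly k → PPoly k
  hat Q x = ⟦ Q x ⟧

  two : Carrier
  two = 1# + 1#

  IsInt : Carrier → Set ℓ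
  IsInt a = ∃ λ (z : ℤ) → a ≈ ℤ→R R z

  -- variable yⱼ does not occur (in the reduced multilinear form)
  flipAt : ∀ {k} → Fin k → Pt k → Pt k
  flipAt j x = updateAt x j not

  NotInB : ∀ {k} → Fin k → BPoly k → Set
  NotInB j Q = ∀ x → Q (flipAt j x) ≡ Q x

  NotInP : ∀ {k} → Fin k → PPoly k → Set ℓ
  NotInP j P = ∀ x → P (flipAt j x) ≈ P x

  sub : ∀ {k} {A : Set c} → Fin k → BPoly k → (Pt k → A) → Pt k → A
  sub j Q F x = F (updateAt x j (const (Q x)))

  subB : ∀ {k} → Fin k → BPoly k → BPoly k → BPoly k
  subB j Q F x = F (updateAt x j (const (Q x)))

  -- removal of a variable from the summation (for polynomials not using it)
  restrict : ∀ {k} {A : Set c} → Fin (suc k) → (Pt (suc k) → A) → Pt k → A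
  restrict j F x = F (insertAt x j false)

  restrictB : ∀ {k} → Fin (suc k) → BPoly (suc k) → BPoly k
  restrictB j F x = F (insertAt x j false)

  -- t = s Σ_{y ∈ V^k} e^{2iπ P(y)} |O(y)⟩⟨I(y)|  :  n → m
  record SOP (n m : ℕ) : Set c where
    constructor mk
    field
      k : ℕ
      s : Carrier
      P : PPoly k
      O : Fin m → BPoly k
      I : Fin n → BPoly k

  substK : ∀ {n m k} → Fin k → BPoly k → Carrier → PPoly k →
           (Fin m → BPoly k) → (Fin n → BPoly k) → SOP n m
  substK {k = k} j Q s P O I =
    mk k s (sub j Q P) (λ i → subB j Q (O i)) (λ i → subB j Q (I i))

  substR : ∀ {n m k} → Fin (suc k) → BPoly (suc k) → Carrier → PPoly (suc k) →
           (Fin m → BPoly (suc k)) → (Fin n → BPoly (suc k)) → SOP n m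
  substR {k = k} j Q s P O I =
    mk k s (restrict j (sub j Q P))
           (λ i → restrictB j (subB j Q (O i)))
           (λ i → restrictB j (subB j Q (I i)))

  -- identification: renaming of summation variables (a bijection σ),
  -- phases equal up to an integer-valued (= integer-coefficient) difference
  record _≅_ {n m : ℕ} (t u : SOP n m) : Set (c ⊔ ℓ) where
    field
      σ     : Fin (SOP.k t) ↔ Fin (SOP.k u)
      scal  : SOP.s t ≈ SOP.s u
      phase : ∀ (y : Pt (SOP.k u)) →
              IsInt (SOP.P t (y ∘ Inverse.to σ) - SOP.P u y)
      outs  : ∀ i (y : Pt (SOP.k u)) → SOP.O t i (y ∘ Inverse.to σ) ≡ SOP.O u i y
      ins   : ∀ i (y : Pt (SOP.k u)) → SOP.I t i (y ∘ Inverse.to σ) ≡ SOP.I u i y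

  data _⟶_ {n m : ℕ} : SOP n m → SOP n m → Set (c ⊔ ℓ) where

    Elim : ∀ {k} s (P : PPoly (suc k)) O I (y₀ : Fin (suc k)) →
           NotInP y₀ P → (∀ i → NotInB y₀ (O i)) → (∀ i → NotInB y₀ (I i)) →
           mk (suc k) s P O I ⟶
           mk k (two * s) (restrict y₀ P) (λ i → restrictB y₀ (O i))
                (λ i → restrictB y₀ (I i))

    HHgen : ∀ {k} s (y₀ yᵢ : Fin (suc k)) (Q Q' : BPoly (suc k))
              (Rp : PPoly (suc k)) O I →
            y₀ ≢ yᵢ →
            (∀ x → (Q x ∧ Q' x) ≡ Q' x) →
            NotInB y₀ Q → NotInB y₀ Q' → NotInP y₀ Rp →
            (∀ i → NotInB y₀ (O i)) → (∀ i → NotInB y₀ (I i)) →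
            NotInB yᵢ Q → NotInB yᵢ Q' →
            mk (suc k) s
               (λ x → half * (hat (λ x → x y₀) x *
                        (hat (λ x → x yᵢ) x * hat Q x + hat Q' x + 1#)) + Rp x)
               O I
            ⟶
            substR yᵢ (λ x → not (Q' x)) s
               (λ x → half * (hat (λ x → x y₀) x *
                        (hat (λ x → x yᵢ) x * hat Q x + hat Q' x + 1#)) + Rp x)
               O I

    ket : ∀ {k} s (P : PPoly k) O I (y₀ : Fin k) (i : Fin m) (O' : BPoly k) →
          (∀ x → O i x ≡ (x y₀ xor O' x)) →
          ¬ (∀ x → O' x ≡ false) →
          (∀ j → toℕ j ℕ.< toℕ i → NotInB y₀ (O j)) →
          NotInB y₀ O' →
          mk k s P O I ⟶ substK y₀ (O i) s P O I

    bra : ∀ {k} s (P : PPoly k) O I (y₀ : Fin k) (i : Fin n) (I' : BPoly k) →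
          (∀ x → I i x ≡ (x y₀ xor I' x)) →
          ¬ (∀ x → I' x ≡ false) →
          (∀ j → NotInB y₀ (O j)) →
          (∀ j → toℕ j ℕ.< toℕ i → NotInB y₀ (I j)) →
          NotInB y₀ I' →
          mk k s P O I ⟶ substK y₀ (I i) s P O I

    Z : ∀ {k} s (y₀ : Fin k) (Rp : PPoly k) O I →
        NotInP y₀ Rp → (∀ i → NotInB y₀ (O i)) → (∀ i → NotInB y₀ (I i)) →
        (¬ (∀ x → Rp x ≈ 0#)
          ⊎ ¬ ((∀ i x → O i x ≡ false) × (∀ i x → I i x ≡ false))) →
        mk k s (λ x → half * hat (λ x → x y₀) x + Rp x) O I ⟶
        mk 1 1# (λ x → half * hat (λ x → x fzero) x)
             (λ _ _ → false) (λ _ _ → false)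

  data _∼_ {n m : ℕ} : SOP n m → SOP n m → Set (c ⊔ ℓ) where
    ident   : ∀ {t u} → t ≅ u → t ∼ u
    step    : ∀ {t u} → t ⟶ u → t ∼ u
    ∼-sym   : ∀ {t u} → t ∼ u → u ∼ t
    ∼-trans : ∀ {t u v} → t ∼ u → u ∼ v → t ∼ v

-- Adjoin a fresh summation variable z and consider the phase
--   ½ y₀ (z ¬Q + 1) + ½ y₀′ (z + Q′ + 1) + R.
-- Eliminating z by (HHgen) through its first summand substitutes z := 1 and gives
-- ½ y₀ (¬Q + 1) + ½ y₀′ (Q′ + 2) + R, which is the phase of t up to an integer.
-- Eliminating z through its second summand substitutes z := ¬Q′ and gives
-- ½ y₀′ (¬Q′ + Q′ + 1) + ½ y₀ (¬Q′ ¬Q + 1) + R ≡ ½ y₀ (Q + Q′ + QQ′) + R (mod ℤ),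
-- in which y₀′ no longer occurs, so (Elim) removes it and doubles the scalar.

{-# OPTIONS --safe #-}
module Submission where

open import Defs
open import Level using (Level)
open import Algebra.Bundles using (CommutativeRing)
open import Algebra.Solver.Ring.AlmostCommutativeRing
  using (_-Raw-AlmostCommutative⟶_; fromCommutativeRing)
open import Data.Bool using (Bool; true; false; not; _∧_)
open import Data.Bool.Properties using (∧-zeroʳ)
open import Data.Fin using (Fin) renaming (zero to fzero; suc to fsuc)
open import Data.Integer using (ℤ; +_; -[1+_]; sign; ∣_∣; _◃_; _⊖_)
import Data.Integer as ℤ
open import Data.Integer.Properties using ([1+m]⊖[1+n]≡m⊖n; ◃-inverse)
open import Data.Maybe using (just; nothing)
open import Data.Nat using (ℕ; zero; suc)
import Data.Nat as ℕ
open import Data.Product using (_,_)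
open import Data.Sign using (Sign)
import Data.Sign as Sign
open import Data.Vec.Functional using (tail)
open import Data.Vec.Functional.Properties using (updateAt-minimal)
open import Function using (_∘_)
open import Function.Construct.Identity using (↔-id)
open import Relation.Binary.Definitions using (WeaklyDecidable)
open import Relation.Binary.PropositionalEquality as ≡ using (_≡_; _≢_; ≢-sym)
open import Relation.Nullary using (yes; no)

module IntegerEmbedding {c ℓ : Level} (R : CommutativeRing c ℓ) where
  open CommutativeRing R
  open import Algebra.Properties.Ring ring using (-0#≈0#; -‿involutive; -‿+-comm; -1*x≈-x)
  open import Algebra.Properties.Semiring.Mult semiring using (_×_; ×-homo-+; ×1-homo-*)
  open import Algebra.Properties.Monoid.Mult.TCOptimised +-monoid
    using () renaming (_×_ to _×′_; ×ᵤ≈× to ×≈×′)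
  open import Algebra.Properties.CommutativeSemigroup +-commutativeSemigroup
    using () renaming (interchange to +-interchange)
  open import Algebra.Properties.CommutativeSemigroup *-commutativeSemigroup
    using () renaming (interchange to *-interchange)
  open import Relation.Binary.Reasoning.Setoid setoid

  ℕ→R≈×1# : ∀ n → ℕ→R R n ≈ n × 1#
  ℕ→R≈×1# zero    = refl
  ℕ→R≈×1# (suc n) = +-congˡ (ℕ→R≈×1# n)

  ℕ→R-+ : ∀ m n → ℕ→R R (m ℕ.+ n) ≈ ℕ→R R m + ℕ→R R n
  ℕ→R-+ m n = begin
    ℕ→R R (m ℕ.+ n)     ≈⟨ ℕ→R≈×1# (m ℕ.+ n) ⟩
    (m ℕ.+ n) × 1#     ≈⟨ ×-homo-+ 1# m n ⟩
    m × 1# + n × 1#    ≈⟨ +-cong (ℕ→R≈×1# m) (ℕ→R≈×1# n) ⟨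
    ℕ→R R m + ℕ→R R n  ∎

  ℕ→R-* : ∀ m n → ℕ→R R (m ℕ.* n) ≈ ℕ→R R m * ℕ→R R n
  ℕ→R-* m n = begin
    ℕ→R R (m ℕ.* n)     ≈⟨ ℕ→R≈×1# (m ℕ.* n) ⟩
    (m ℕ.* n) × 1#     ≈⟨ ×1-homo-* m n ⟩
    m × 1# * (n × 1#)  ≈⟨ *-cong (ℕ→R≈×1# m) (ℕ→R≈×1# n) ⟨
    ℕ→R R m * ℕ→R R n  ∎

  ℤ→R-⊖ : ∀ m n → ℤ→R R (m ⊖ n) ≈ ℕ→R R m - ℕ→R R n
  ℤ→R-⊖ m       zero    = sym (trans (+-congˡ -0#≈0#) (+-identityʳ _))
  ℤ→R-⊖ zero    (suc n) = sym (+-identityˡ _)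
  ℤ→R-⊖ (suc m) (suc n) = begin
    ℤ→R R (suc m ⊖ suc n)              ≡⟨ ≡.cong (ℤ→R R) ([1+m]⊖[1+n]≡m⊖n m n) ⟩
    ℤ→R R (m ⊖ n)                      ≈⟨ ℤ→R-⊖ m n ⟩
    ℕ→R R m - ℕ→R R n                  ≈⟨ +-identityˡ _ ⟨
    0# + (ℕ→R R m - ℕ→R R n)           ≈⟨ +-congʳ (-‿inverseʳ 1#) ⟨
    (1# - 1#) + (ℕ→R R m - ℕ→R R n)    ≈⟨ +-interchange 1# (ℕ→R R m) (- 1#) (- ℕ→R R n) ⟨
    (1# + ℕ→R R m) + (- 1# - ℕ→R R n)  ≈⟨ +-congˡ (-‿+-comm 1# (ℕ→R R n)) ⟩
    (1# + ℕ→R R m) - (1# + ℕ→R R n)    ∎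

  ℤ→R-+ : ∀ i j → ℤ→R R (i ℤ.+ j) ≈ ℤ→R R i + ℤ→R R j
  ℤ→R-+ -[1+ m ] -[1+ n ] = begin
    - (1# + (1# + ℕ→R R (m ℕ.+ n)))      ≈⟨ -‿cong (+-congˡ (+-congˡ (ℕ→R-+ m n))) ⟩
    - (1# + (1# + (ℕ→R R m + ℕ→R R n)))  ≈⟨ -‿cong (+-assoc 1# 1# _) ⟨
    - ((1# + 1#) + (ℕ→R R m + ℕ→R R n))  ≈⟨ -‿cong (+-interchange 1# (ℕ→R R m) 1# (ℕ→R R n)) ⟨
    - ((1# + ℕ→R R m) + (1# + ℕ→R R n))  ≈⟨ -‿+-comm _ _ ⟨
    - (1# + ℕ→R R m) - (1# + ℕ→R R n)    ∎
  ℤ→R-+ -[1+ m ] (+ n)    = trans (ℤ→R-⊖ n (suc m)) (+-comm _ _)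
  ℤ→R-+ (+ m)    -[1+ n ] = ℤ→R-⊖ m (suc n)
  ℤ→R-+ (+ m)    (+ n)    = ℕ→R-+ m n

  ℤ→R-neg : ∀ i → ℤ→R R (ℤ.- i) ≈ - ℤ→R R i
  ℤ→R-neg -[1+ n ]    = sym (-‿involutive _)
  ℤ→R-neg (+ zero)    = sym -0#≈0#
  ℤ→R-neg (+ (suc n)) = refl

  signToR : Sign → Carrier
  signToR Sign.+ = 1#
  signToR Sign.- = - 1#

  signToR-* : ∀ s t → signToR (s Sign.* t) ≈ signToR s * signToR t
  signToR-* Sign.+ t      = sym (*-identityˡ _)
  signToR-* Sign.- Sign.+ = sym (*-identityʳ _)
  signToR-* Sign.- Sign.- = sym (trans (-1*x≈-x (- 1#)) (-‿involutive 1#))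

  ℤ→R-◃ : ∀ s n → ℤ→R R (s ◃ n) ≈ signToR s * ℕ→R R n
  ℤ→R-◃ s      zero    = sym (zeroʳ _)
  ℤ→R-◃ Sign.+ (suc n) = sym (*-identityˡ _)
  ℤ→R-◃ Sign.- (suc n) = sym (-1*x≈-x _)

  ℤ→R≈sign*∣∣ : ∀ i → ℤ→R R i ≈ signToR (sign i) * ℕ→R R ∣ i ∣
  ℤ→R≈sign*∣∣ i = begin
    ℤ→R R i                         ≡⟨ ≡.cong (ℤ→R R) (◃-inverse i) ⟨
    ℤ→R R (sign i ◃ ∣ i ∣)          ≈⟨ ℤ→R-◃ (sign i) ∣ i ∣ ⟩
    signToR (sign i) * ℕ→R R ∣ i ∣  ∎

  ℤ→R-* : ∀ i j → ℤ→R R (i ℤ.* j) ≈ ℤ→R R i * ℤ→R R j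
  ℤ→R-* i j = begin
    ℤ→R R (i ℤ.* j)
      ≈⟨ ℤ→R-◃ (sign i Sign.* sign j) (∣ i ∣ ℕ.* ∣ j ∣) ⟩
    signToR (sign i Sign.* sign j) * ℕ→R R (∣ i ∣ ℕ.* ∣ j ∣)
      ≈⟨ *-cong (signToR-* (sign i) (sign j)) (ℕ→R-* ∣ i ∣ ∣ j ∣) ⟩
    (signToR (sign i) * signToR (sign j)) * (ℕ→R R ∣ i ∣ * ℕ→R R ∣ j ∣)
      ≈⟨ *-interchange _ _ _ _ ⟩
    (signToR (sign i) * ℕ→R R ∣ i ∣) * (signToR (sign j) * ℕ→R R ∣ j ∣)
      ≈⟨ *-cong (ℤ→R≈sign*∣∣ i) (ℤ→R≈sign*∣∣ j) ⟨
    ℤ→R R i * ℤ→R R j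
      ∎

  -- Agrees with ℤ→R R, but sends + 1 to 1# and + 2 to 1# + 1# definitionally, so that
  -- the solver's integer constants are the literals occurring in phases.
  ℤ→R′ : ℤ → Carrier
  ℤ→R′ (+ n)    = n ×′ 1#
  ℤ→R′ -[1+ n ] = - (suc n ×′ 1#)

  ℤ→R′≈ℤ→R : ∀ i → ℤ→R′ i ≈ ℤ→R R i
  ℤ→R′≈ℤ→R (+ n)    = sym (trans (ℕ→R≈×1# n) (×≈×′ n 1#))
  ℤ→R′≈ℤ→R -[1+ n ] = -‿cong (ℤ→R′≈ℤ→R (+ suc n))

  ℤ→R′-homomorphism : ℤ.+-*-rawRing -Raw-AlmostCommutative⟶ fromCommutativeRing R
  ℤ→R′-homomorphism = record
    { ⟦_⟧    = ℤ→R′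
    ; +-homo = λ i j → trans (ℤ→R′≈ℤ→R (i ℤ.+ j))
                         (trans (ℤ→R-+ i j) (sym (+-cong (ℤ→R′≈ℤ→R i) (ℤ→R′≈ℤ→R j))))
    ; *-homo = λ i j → trans (ℤ→R′≈ℤ→R (i ℤ.* j))
                         (trans (ℤ→R-* i j) (sym (*-cong (ℤ→R′≈ℤ→R i) (ℤ→R′≈ℤ→R j))))
    ; -‿homo = λ i → trans (ℤ→R′≈ℤ→R (ℤ.- i)) (trans (ℤ→R-neg i) (-‿cong (sym (ℤ→R′≈ℤ→R i))))
    ; 0-homo = refl
    ; 1-homo = refl
    }

  ℤ→R′-≟ : WeaklyDecidable (λ i j → ℤ→R′ i ≈ ℤ→R′ j)
  ℤ→R′-≟ i j with i ℤ.≟ j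
  ... | yes ≡.refl = just refl
  ... | no _       = nothing

  open import Algebra.Solver.Ring ℤ.+-*-rawRing (fromCommutativeRing R) ℤ→R′-homomorphism ℤ→R′-≟
    public using (solve; _:=_; _:+_; _:*_; _:-_; con)

module SOPLemmas {c ℓ : Level} (R : CommutativeRing c ℓ) (PR : IsPhaseRing R) where
  open CommutativeRing R
  open IsPhaseRing PR
  open SOPs R PR
  open IntegerEmbedding R
  open import Algebra.Properties.Ring ring using (-0#≈0#)

  IsInt-resp : ∀ {x y} → x ≈ y → IsInt x → IsInt y
  IsInt-resp x≈y (i , x≈i) = i , trans (sym x≈y) x≈i

  IsInt-+ : ∀ {x y} → IsInt x → IsInt y → IsInt (x + y)
  IsInt-+ (i , x≈i) (j , y≈j) = i ℤ.+ j , trans (+-cong x≈i y≈j) (sym (ℤ→R-+ i j))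

  IsInt-neg : ∀ {x} → IsInt x → IsInt (- x)
  IsInt-neg (i , x≈i) = ℤ.- i , trans (-‿cong x≈i) (sym (ℤ→R-neg i))

  IsInt-* : ∀ {x y} → IsInt x → IsInt y → IsInt (x * y)
  IsInt-* (i , x≈i) (j , y≈j) = i ℤ.* j , trans (*-cong x≈i y≈j) (sym (ℤ→R-* i j))

  IsInt-⟦⟧ : ∀ b → IsInt ⟦ b ⟧
  IsInt-⟦⟧ true  = + 1 , sym (+-identityʳ 1#)
  IsInt-⟦⟧ false = + 0 , refl

  IsInt-[half+half]* : ∀ {x z} → x ≈ (half + half) * z → IsInt z → IsInt x
  IsInt-[half+half]* {z = z} x≈ = IsInt-resp (sym (trans x≈ (trans (*-congʳ half+half) (*-identityˡ z))))

  ⟦not⟧ : ∀ b → ⟦ not b ⟧ ≈ 1# - ⟦ b ⟧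
  ⟦not⟧ true  = sym (-‿inverseʳ 1#)
  ⟦not⟧ false = sym (trans (+-congˡ -0#≈0#) (+-identityʳ 1#))

  ⟦∧⟧ : ∀ b b′ → ⟦ b ∧ b′ ⟧ ≈ ⟦ b ⟧ * ⟦ b′ ⟧
  ⟦∧⟧ true  b′ = sym (*-identityˡ _)
  ⟦∧⟧ false b′ = sym (zeroˡ _)

  HHphase : Bool → Bool → Bool → Bool → Carrier
  HHphase y₀ yᵢ Q Q′ = half * (⟦ y₀ ⟧ * (⟦ yᵢ ⟧ * ⟦ Q ⟧ + ⟦ Q′ ⟧ + 1#))

  IsInt-phase-z:=1 : ∀ (a q b p : Bool) r →
    IsInt ((half * (⟦ a ⟧ * ⟦ q ⟧) + half * (⟦ b ⟧ * ⟦ p ⟧) + r)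
           - (HHphase a true (not q) false + (HHphase b true true p + r)))
  IsInt-phase-z:=1 a q b p r = IsInt-[half+half]*
    (trans (+-congˡ (-‿cong (+-congʳ (*-congˡ (*-congˡ (+-congʳ (+-congʳ (*-congˡ (⟦not⟧ q)))))))))
           (solve 6 (λ h a q b p r →
                      (h :* (a :* q) :+ h :* (b :* p) :+ r)
                      :- (h :* (a :* (con (+ 1) :* (con (+ 1) :- q) :+ con (+ 0) :+ con (+ 1)))
                          :+ (h :* (b :* (con (+ 1) :* con (+ 1) :+ p :+ con (+ 1))) :+ r))
                      := (h :+ h) :* (a :* q :- a :- b))
                  refl half ⟦ a ⟧ ⟦ q ⟧ ⟦ b ⟧ ⟦ p ⟧ r))
    (IsInt-+ (IsInt-+ (IsInt-* (IsInt-⟦⟧ a) (IsInt-⟦⟧ q)) (IsInt-neg (IsInt-⟦⟧ a)))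
             (IsInt-neg (IsInt-⟦⟧ b)))

  IsInt-phase-z:=¬p : ∀ (b p a q : Bool) r →
    IsInt ((HHphase b (not p) true p + (HHphase a (not p) (not q) false + r))
           - (half * (⟦ a ⟧ * (⟦ q ⟧ + ⟦ p ⟧ + ⟦ q ∧ p ⟧)) + r))
  IsInt-phase-z:=¬p b p a q r = IsInt-[half+half]*
    (trans (+-cong (+-cong (*-congˡ (*-congˡ (+-congʳ (+-congʳ (*-congʳ (⟦not⟧ p))))))
                           (+-congʳ (*-congˡ (*-congˡ (+-congʳ (+-congʳ (*-cong (⟦not⟧ p) (⟦not⟧ q))))))))
                   (-‿cong (+-congʳ (*-congˡ (*-congˡ (+-congˡ (⟦∧⟧ q p)))))))
           (solve 6 (λ h b p a q r →
                      (h :* (b :* ((con (+ 1) :- p) :* con (+ 1) :+ p :+ con (+ 1)))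
                       :+ (h :* (a :* ((con (+ 1) :- p) :* (con (+ 1) :- q) :+ con (+ 0) :+ con (+ 1)))
                           :+ r))
                      :- (h :* (a :* (q :+ p :+ q :* p)) :+ r)
                      := (h :+ h) :* (b :+ a :- a :* p :- a :* q))
                  refl half ⟦ b ⟧ ⟦ p ⟧ ⟦ a ⟧ ⟦ q ⟧ r))
    (IsInt-+ (IsInt-+ (IsInt-+ (IsInt-⟦⟧ b) (IsInt-⟦⟧ a))
                      (IsInt-neg (IsInt-* (IsInt-⟦⟧ a) (IsInt-⟦⟧ p))))
             (IsInt-neg (IsInt-* (IsInt-⟦⟧ a) (IsInt-⟦⟧ q))))

  IsInt-swap : ∀ x y z → IsInt ((x + (y + z)) - (y + (x + z)))
  IsInt-swap x y z = IsInt-resp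
    (sym (solve 3 (λ x y z → (x :+ (y :+ z)) :- (y :+ (x :+ z)) := con (+ 0)) refl x y z))
    (+ 0 , refl)

  phase-shift : ∀ {n m k s} {P P′ : PPoly k} {O : Fin m → BPoly k} {I : Fin n → BPoly k} →
                (∀ x → IsInt (P x - P′ x)) → mk k s P O I ∼ mk k s P′ O I
  phase-shift {k = k} P-P′ = ident (record
    { σ = ↔-id (Fin k) ; scal = refl ; phase = P-P′ ; outs = λ _ _ → ≡.refl ; ins = λ _ _ → ≡.refl })

  coordinate-NotInB : ∀ {k} {i j : Fin k} → i ≢ j → NotInB j (λ x → x i)
  coordinate-NotInB {i = i} {j} i≢j x = updateAt-minimal i j x i≢j

  NotInP-combine : ∀ {k} {j : Fin k} (f : Bool → Bool → Bool → Bool → Carrier) (A B C D : BPoly k)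
                     {Rp : PPoly k} →
                   NotInB j A → NotInB j B → NotInB j C → NotInB j D → NotInP j Rp →
                   NotInP j (λ x → f (A x) (B x) (C x) (D x) + Rp x)
  NotInP-combine f A B C D j∉A j∉B j∉C j∉D j∉Rp x
    rewrite j∉A x | j∉B x | j∉C x | j∉D x = +-congˡ (j∉Rp x)

  HH-fresh-variable : ∀ {n m k} s {y y′ : Fin (suc k)} → y ≢ y′ → (A B C D : BPoly (suc k))
                        (Rp : PPoly (suc k)) (O : Fin m → BPoly (suc k)) (I : Fin n → BPoly (suc k)) →
                      (∀ x → (A x ∧ B x) ≡ B x) →
                      NotInB y A → NotInB y B → NotInB y C → NotInB y D → NotInP y Rp →
                      (∀ i → NotInB y (O i)) → (∀ i → NotInB y (I i)) →
                      mk (suc (suc k)) s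
                         (λ x → HHphase (x (fsuc y)) (x fzero) (A (tail x)) (B (tail x))
                                + (HHphase (x (fsuc y′)) (x fzero) (C (tail x)) (D (tail x))
                                   + Rp (tail x)))
                         (λ i → O i ∘ tail) (λ i → I i ∘ tail)
                      ⟶
                      mk (suc k) s
                         (λ x → HHphase (x y) (not (B x)) (A x) (B x)
                                + (HHphase (x y′) (not (B x)) (C x) (D x) + Rp x))
                         O I
  HH-fresh-variable s {y} {y′} y≢y′ A B C D Rp O I AB≡B y∉A y∉B y∉C y∉D y∉Rp y∉O y∉I =
    HHgen s (fsuc y) fzero (A ∘ tail) (B ∘ tail) _ _ _ (λ ()) (AB≡B ∘ tail)
          (y∉A ∘ tail) (y∉B ∘ tail)
          (NotInP-combine {j = fsuc y} HHphase
             (λ x → x (fsuc y′)) (λ x → x fzero) (C ∘ tail) (D ∘ tail)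
             (coordinate-NotInB (≢-sym y≢y′) ∘ tail) (λ _ → ≡.refl) (y∉C ∘ tail) (y∉D ∘ tail)
             (y∉Rp ∘ tail))
          (λ i → y∉O i ∘ tail) (λ i → y∉I i ∘ tail) (λ _ → ≡.refl) (λ _ → ≡.refl)

lemma2p10 : ∀ {c ℓ : Level} (R : CommutativeRing c ℓ) (PR : IsPhaseRing R) →
  let open CommutativeRing R
      open IsPhaseRing PR
      open SOPs R PR
  in ∀ {n m k : ℕ} (s : Carrier) (y₀ y₀' : Fin (suc k))
       (Q Q' : BPoly (suc k)) (Rp : PPoly (suc k))
       (O : Fin m → BPoly (suc k)) (I : Fin n → BPoly (suc k)) →
     y₀ ≢ y₀' →
     NotInB y₀ Q → NotInB y₀ Q' → NotInP y₀ Rp →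
     (∀ i → NotInB y₀ (O i)) → (∀ i → NotInB y₀ (I i)) →
     NotInB y₀' Q → NotInB y₀' Q' → NotInP y₀' Rp →
     (∀ i → NotInB y₀' (O i)) → (∀ i → NotInB y₀' (I i)) →
     mk (suc k) s
        (λ x → half * (hat (λ x → x y₀) x * hat Q x)
               + half * (hat (λ x → x y₀') x * hat Q' x) + Rp x)
        O I
     ∼
     mk k (two * s)
        (restrict y₀' (λ x → half * (hat (λ x → x y₀) x *
                            (hat Q x + hat Q' x + hat (λ x → Q x ∧ Q' x) x))
                            + Rp x))
        (λ i → restrictB y₀' (O i))
        (λ i → restrictB y₀' (I i))
lemma2p10 R PR s y₀ y₀′ Q Q′ Rp O I y₀≢y₀′
          y₀∉Q y₀∉Q′ y₀∉Rp y₀∉O y₀∉I y₀′∉Q y₀′∉Q′ y₀′∉Rp y₀′∉O y₀′∉I =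
  ∼-trans (phase-shift λ x → IsInt-phase-z:=1 (x y₀) (Q x) (x y₀′) (Q′ x) (Rp x))
  (∼-trans (∼-sym (step (HH-fresh-variable s y₀≢y₀′ (not ∘ Q) (λ _ → false) (λ _ → true) Q′ Rp O I
                           (λ _ → ∧-zeroʳ _) (λ x → ≡.cong not (y₀∉Q x)) (λ _ → ≡.refl)
                           (λ _ → ≡.refl) y₀∉Q′ y₀∉Rp y₀∉O y₀∉I)))
  (∼-trans (phase-shift λ x → IsInt-swap _ _ _)
  (∼-trans (step (HH-fresh-variable s (≢-sym y₀≢y₀′) (λ _ → true) Q′ (not ∘ Q) (λ _ → false) Rp O I
                   (λ _ → ≡.refl) (λ _ → ≡.refl) y₀′∉Q′ (λ x → ≡.cong not (y₀′∉Q x))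
                   (λ _ → ≡.refl) y₀′∉Rp y₀′∉O y₀′∉I))
  (∼-trans (phase-shift λ x → IsInt-phase-z:=¬p (x y₀′) (Q′ x) (x y₀) (Q x) (Rp x))
  (step (Elim s _ O I y₀′
          (NotInP-combine {j = y₀′} (λ a q q′ qq′ → half * (⟦ a ⟧ * (⟦ q ⟧ + ⟦ q′ ⟧ + ⟦ qq′ ⟧)))
             (λ x → x y₀) Q Q′ (λ x → Q x ∧ Q′ x)
             (coordinate-NotInB y₀≢y₀′) y₀′∉Q y₀′∉Q′
             (λ x → ≡.cong₂ _∧_ (y₀′∉Q x) (y₀′∉Q′ x)) y₀′∉Rp)
          y₀′∉O y₀′∉I))))))
  where
  open CommutativeRing R
  open IsPhaseRing PR
  open SOPs R PR
  open SOPLemmas R PR
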